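{- For any set $\Gamma$ of axioms, well-formed programs $C_1,C_2$ and $P,Q,R\subseteq\Sigma$: if $\Gamma\vdash\langle [P]\rangle\, C_1\,\langle\square Q\rangle$ and $\Gamma\vdash\langle [Q]\rangle\, C_2\,\langle\square R\rangle$, then $\Gamma\vdash\langle [P]\rangle\, C_1;C_2\,\langle\square R\rangle$.
   Context: Semiring: $\mathcal A=\langle U,+,\cdot,\mathbf 0,\mathbf 1\rangle$ is a partial semiring: $\langle U,+,\mathbf 0\rangle$ is a commutative monoid whose operation $+$ may be partial, $\langle U,\cdot,\mathbf 1\rangle$ is a (total) monoid, $\cdot$ distributes over $+$ on both sides, and $\mathbf 0\cdot u=u\cdot\mathbf 0=\mathbf 0$; naturally ordered ($u\le v$ iff $\exists w.\,u+w=v$ is a partial order), Scott continuous ($+$, both-sided $\cdot$ preserve directed suprema), with a top element; $\sum_{i\in I}u_i$ = supremum of finite partial sums. $\mathcal W(\Sigma)$: maps $m:\Sigma\to U$ with countable support $\mathrm{supp}(m)=\{\sigma:m(\sigma)\ne\mathbf 0\}$ and defined mass $|m|=\sum_{\sigma\in\mathrm{supp}(m)}m(\sigma)$; pointwise operations; $\eta(\sigma)$ point mass of weight $\mathbf 1$; $f^\dagger(m)(\tau)=\sum_{\sigma\in\mathrm{supp}(m)}m(\sigma)\cdot f(\sigma)(\tau)$. Programs: $C::=\mathsf{skip}\mid C_1;C_2\mid C_1+C_2\mid\mathsf{assume}\ e\mid C^{\langle e,e'\rangle}\mid a$ ($a$ atomic action with given $[\![a]\!]:\Sigma\to\mathcal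 W(\Sigma)$), $e::=b\mid u$, tests $b$ Boolean combinations of primitive tests $t\subseteq\Sigma$ evaluating to $\{\mathbf 0,\mathbf 1\}$. Semantics: $[\![\mathsf{skip}]\!]=\eta$, $[\![C_1;C_2]\!](\sigma)=[\![C_2]\!]^\dagger([\![C_1]\!](\sigma))$, $[\![C_1+C_2]\!](\sigma)=[\![C_1]\!](\sigma)+[\![C_2]\!](\sigma)$, $[\![\mathsf{assume}\ e]\!](\sigma)=[\![e]\!](\sigma)\cdot\eta(\sigma)$, $[\![C^{\langle e,e'\rangle}]\!]$ least fixed point of $\Phi(f)(\sigma)=[\![e]\!](\sigma)\cdot f^\dagger([\![C]\!](\sigma))+[\![e']\!](\sigma)\cdot\eta(\sigma)$; well-formed = total. Assertions: subsets of $\mathcal W(\Sigma)$; $\top,\bot,\land=\cap,\lor=\cup$, $\exists x{:}T.\phi(x)=\bigcup_t\phi(t)$, $\bigoplus_{x\in T}\phi(x)=\{\sum_t m_t: m_t\in\phi(t)\}$, binary $\oplus$, $u\odot\varphi=\{u\cdot m\}$, $\varphi\odot u=\{m\cdot u\}$. For $P\subseteq\Sigma$: $[P]_u=\{m:|m|=u,\mathrm{supp}(m)\subseteq P\}$, $[P]=[P]_{\mathbf 1}$, $\square P=\{m:\mathrm{supp}(m)\subseteq P\}$. $\varphi\models e=u$: $[\![e]\!](\sigma)=u$ for all $m\in\varphi,\sigma\in\mathrm{supp}(m)$. $(\psi_n)$ converges to $\psi_\infty$ if $m_n\in\psi_n\ \forall n$ implies $\sum_n m_n\in\psi_\infty$.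 Proof system $\Gamma\vdash$: axioms in $\Gamma$ (triples about atomic actions) plus rules (Skip) $\langle\varphi\rangle\mathsf{skip}\langle\varphi\rangle$; (Seq) from $\langle\varphi\rangle C_1\langle\vartheta\rangle$, $\langle\vartheta\rangle C_2\langle\psi\rangle$ infer $\langle\varphi\rangle C_1;C_2\langle\psi\rangle$; (Plus) from $\langle\varphi\rangle C_i\langle\psi_i\rangle$ infer $\langle\varphi\rangle C_1+C_2\langle\psi_1\oplus\psi_2\rangle$; (Assume) if $\varphi\models e=u$ then $\langle\varphi\rangle\mathsf{assume}\ e\langle\varphi\odot u\rangle$; (Iter) if $(\psi_n)$ converges to $\psi_\infty$, and for all $n$, $\langle\varphi_n\rangle\mathsf{assume}\ e;C\langle\varphi_{n+1}\rangle$ and $\langle\varphi_n\rangle\mathsf{assume}\ e'\langle\psi_n\rangle$, then $\langle\varphi_0\rangle C^{\langle e,e'\rangle}\langle\psi_\infty\rangle$; (False) $\langle\bot\rangle C\langle\varphi\rangle$; (True) $\langle\varphi\rangle C\langle\top\rangle$; (Scale) from $\langle\varphi\rangle C\langle\psi\rangle$ infer $\langle u\odot\varphi\rangle C\langle u\odot\psi\rangle$; (Disj)/(Conj) combine two triples by $\lor$/$\land$; (Choice) from $\langle\phi(t)\rangle C\langle\phi'(t)\rangle\ \forall t\in T$ infer $\langle\bigoplus_x\phi(x)\rangle C\langle\bigoplus_x\phi'(x)\rangle$; (Exists) same with $\exists x{:}T$; (Consequence) if $\varphi'\subseteq\varphi$, $\langle\varphi\rangle C\langle\psi\rangle$, $\psi\subseteq\psi'$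 then $\langle\varphi'\rangle C\langle\psi'\rangle$. -}

module Defs where

open import Data.Nat using (ℕ; zero; suc)
open import Data.Bool using (Bool; true; false; if_then_else_; _∧_; _∨_; not)
open import Data.Maybe using (Maybe; just)
open import Data.List using (List; []; _∷_; map)
open import Data.List.Relation.Unary.All using (All)
open import Data.List.Relation.Unary.Unique.Propositional using (Unique)
open import Data.Product using (Σ; ∃; _×_; _,_; ∃-syntax)
open import Data.Sum using (_⊎_)
open import Data.Unit using (⊤)
open import Data.Empty using (⊥)
open import Relation.Binary.PropositionalEquality using (_≡_; _≢_)

-- Algebraic core: ⟨U,+,𝟘⟩ a partial commutative monoid (+ given as a
-- functional relation  u + v ≃ w  "u+v is defined and equals w"),
-- ⟨U,·,𝟙⟩ a total monoid, · distributes over + on both sides, 𝟘 absorbing.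
record PSRCore : Set₁ where
  infix 4 _+_≃_
  infixl 7 _·_
  field
    U      : Set
    _+_≃_  : U → U → U → Set
    𝟘 𝟙    : U
    _·_    : U → U → U
    +-functional : ∀ {u v w w'} → u + v ≃ w → u + v ≃ w' → w ≡ w'
    +-identityʳ  : ∀ u → u + 𝟘 ≃ u
    +-comm       : ∀ {u v w} → u + v ≃ w → v + u ≃ w
    -- (u+v)+w defined ⇒ u+(v+w) defined and equal (with +-comm this
    -- gives the usual Kleene-equality form of associativity)
    +-assoc      : ∀ {u v w uv r} → u + v ≃ uv → uv + w ≃ r →
                   ∃[ vw ] (v + w ≃ vw × u + vw ≃ r)
    ·-assoc      : ∀ u v w → (u · v) · w ≡ u · (v · w)
    ·-identityˡ  : ∀ u → 𝟙 · u ≡ u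
    ·-identityʳ  : ∀ u → u · 𝟙 ≡ u
    distribˡ     : ∀ {u v w} x → u + v ≃ w → x · u + x · v ≃ x · w
    distribʳ     : ∀ {u v w} x → u + v ≃ w → u · x + v · x ≃ w · x
    zeroˡ        : ∀ u → 𝟘 · u ≡ 𝟘
    zeroʳ        : ∀ u → u · 𝟘 ≡ 𝟘

module CoreDefs (R : PSRCore) where
  open PSRCore R

  _≤_ : U → U → Set
  u ≤ v = ∃[ w ] (u + w ≃ v)

  IsSup : {I : Set} → (I → U) → U → Set
  IsSup {I} f s = (∀ i → f i ≤ s) × (∀ b → (∀ i → f i ≤ b) → s ≤ b)

  IsSupSet : (U → Set) → U → Set
  IsSupSet X s = (∀ t → X t → t ≤ s) × (∀ b → (∀ t → X t → t ≤ b) → s ≤ b)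

  Directed : {I : Set} → (I → U) → Set
  Directed {I} f = I × (∀ i j → ∃[ k ] (f i ≤ f k × f j ≤ f k))

  Directed₂ : {I : Set} → (I → U) → (I → U) → Set
  Directed₂ {I} f g = I × (∀ i j → ∃[ k ] ((f i ≤ f k × g i ≤ g k) × (f j ≤ f k × g j ≤ g k)))

  -- finite sums of lists (may be undefined since + is partial)
  data FinSum : List U → U → Set where
    []ˢ  : FinSum [] 𝟘
    consˢ : ∀ {u us s t} → FinSum us s → u + s ≃ t → FinSum (u ∷ us) t

  -- s = Σ_{i ∈ S} f i : every finite partial sum (over finitely many
  -- distinct indices in S) is defined, and s is their supremum.
  HasSumOn : {I : Set} → (I → Set) → (I → U) → U → Set
  HasSumOn {I} S f s =
    (∀ (is : List I) → Unique is → All S is → ∃[ t ] FinSum (map f is) t) ×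
    IsSupSet (λ t → ∃[ is ] (Unique is × All S is × FinSum (map f is) t)) s

record PartialSemiring : Set₁ where
  field
    core : PSRCore
  open PSRCore core public
  open CoreDefs core public
  field
    ≤-antisym : ∀ {u v} → u ≤ v → v ≤ u → u ≡ v
    ⊤ᵤ        : U
    ≤-top     : ∀ u → u ≤ ⊤ᵤ
    +-scott   : ∀ {I : Set} (f g h : I → U) (s t : U) → Directed₂ f g →
                IsSup f s → IsSup g t → (∀ i → f i + g i ≃ h i) →
                ∃[ r ] (s + t ≃ r × IsSup h r)
    ·-scottˡ  : ∀ {I : Set} (f : I → U) (s x : U) → Directed f → IsSup f s →
                IsSup (λ i → x · f i) (x · s)
    ·-scottʳ  : ∀ {I : Set} (f : I → U) (s x : U) → Directed f → IsSup f s →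
                IsSup (λ i → f i · x) (s · x)

module Framework (A : PartialSemiring) (St : Set) (Act : Set) (PTest : Set)
                 (testSem : PTest → St → Bool) where
  open PartialSemiring A

  record W : Set where
    field
      fun          : St → U
      countable    : Σ (ℕ → Maybe St) λ e → ((σ : St) → fun σ ≢ 𝟘 → ∃[ n ] (e n ≡ just σ))
                     -- e : ℕ → Maybe St enumerates (a superset of) the support
      mass-defined : ∃[ u ] HasSumOn (λ σ → fun σ ≢ 𝟘) fun u
  open W public

  supp : W → St → Set
  supp m σ = fun m σ ≢ 𝟘

  Mass : W → U → Set
  Mass m u = HasSumOn (supp m) (fun m) u

  _≈_ : W → W → Set
  m ≈ n = ∀ σ → fun m σ ≡ fun n σ

  IsEta : St → W → Set
  IsEta σ m = ∀ τ → (τ ≡ σ → fun m τ ≡ 𝟙) × (τ ≢ σ → fun m τ ≡ 𝟘)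

  PlusW : W → W → W → Set
  PlusW m₁ m₂ n = ∀ τ → fun m₁ τ + fun m₂ τ ≃ fun n τ

  ScaleL : U → W → W → Set
  ScaleL u m n = ∀ τ → fun n τ ≡ u · fun m τ

  ScaleR : W → U → W → Set
  ScaleR m u n = ∀ τ → fun n τ ≡ fun m τ · u

  Bind : (St → W) → W → W → Set
  Bind f m n = ∀ τ → HasSumOn (supp m) (λ σ → fun m σ · fun (f σ) τ) (fun n τ)

  _⊑_ : (St → W) → (St → W) → Set
  f ⊑ g = ∀ σ τ → fun (f σ) τ ≤ fun (g σ) τ

  data Test : Set where
    prim     : PTest → Test
    tt ff    : Test
    neg      : Test → Test
    and or   : Test → Test → Test

  data Exp : Set where
    test  : Test → Exp
    const : U → Exp

  infixr 5 _︔_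
  infixr 4 _⊕ₚ_
  data Prog : Set where
    skip   : Prog
    _︔_    : Prog → Prog → Prog
    _⊕ₚ_   : Prog → Prog → Prog
    assume : Exp → Prog
    iter   : Prog → Exp → Exp → Prog
    act    : Act → Prog

  testEval : Test → St → Bool
  testEval (prim t)  σ = testSem t σ
  testEval tt        σ = true
  testEval ff        σ = false
  testEval (neg b)   σ = not (testEval b σ)
  testEval (and b c) σ = testEval b σ ∧ testEval c σ
  testEval (or b c)  σ = testEval b σ ∨ testEval c σ

  expSem : Exp → St → U
  expSem (test b)  σ = if testEval b σ then 𝟙 else 𝟘
  expSem (const u) σ = u

  PhiRel : (St → W) → Exp → Exp → (St → W) → (St → W) → Set
  PhiRel g e e' h h' = ∀ σ → ∃[ b ] ∃[ ησ ] ∃[ x ] ∃[ y ]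
    (Bind h (g σ) b × IsEta σ ησ × ScaleL (expSem e σ) b x ×
     ScaleL (expSem e' σ) ησ y × PlusW x y (h' σ))

  -- Den actSem C f : ⟦C⟧ is total and equals f
  Den : (Act → St → W) → Prog → (St → W) → Set
  Den actSem skip f = ∀ σ → IsEta σ (f σ)
  Den actSem (C₁ ︔ C₂) f = ∃[ f₁ ] ∃[ f₂ ]
    (Den actSem C₁ f₁ × Den actSem C₂ f₂ × (∀ σ → Bind f₂ (f₁ σ) (f σ)))
  Den actSem (C₁ ⊕ₚ C₂) f = ∃[ f₁ ] ∃[ f₂ ]
    (Den actSem C₁ f₁ × Den actSem C₂ f₂ × (∀ σ → PlusW (f₁ σ) (f₂ σ) (f σ)))
  Den actSem (assume e) f = ∀ σ → ∃[ ησ ] (IsEta σ ησ × ScaleL (expSem e σ) ησ (f σ))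
  Den actSem (iter C e e') f = ∃[ g ]
    (Den actSem C g × PhiRel g e e' f f × (∀ h → PhiRel g e e' h h → f ⊑ h))
  Den actSem (act a) f = ∀ σ → f σ ≈ actSem a σ

  -- well-formed = semantics is total
  WellFormed : (Act → St → W) → Prog → Set
  WellFormed actSem C = ∃[ f ] Den actSem C f

  Assertion : Set₁
  Assertion = W → Set

  _⊆_ : Assertion → Assertion → Set
  φ ⊆ ψ = ∀ m → φ m → ψ m

  ⊤ₐ ⊥ₐ : Assertion
  ⊤ₐ m = ⊤
  ⊥ₐ m = ⊥

  _∧ₐ_ _∨ₐ_ _⊕_ : Assertion → Assertion → Assertion
  (φ ∧ₐ ψ) m = φ m × ψ m
  (φ ∨ₐ ψ) m = φ m ⊎ ψ m
  (φ ⊕ ψ) m = ∃[ m₁ ] ∃[ m₂ ] (φ m₁ × ψ m₂ × PlusW m₁ m₂ m)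

  ∃ₐ : (T : Set) → (T → Assertion) → Assertion
  ∃ₐ T φ m = ∃[ t ] φ t m

  ⨁ : (T : Set) → (T → Assertion) → Assertion
  ⨁ T φ m = Σ (T → W) λ ms → ((∀ (t : T) → φ t (ms t)) ×
                     (∀ τ → HasSumOn (λ _ → ⊤) (λ t → fun (ms t) τ) (fun m τ)))

  _⊙ˡ_ : U → Assertion → Assertion
  (u ⊙ˡ φ) m = ∃[ m' ] (φ m' × ScaleL u m' m)

  _⊙ʳ_ : Assertion → U → Assertion
  (φ ⊙ʳ u) m = ∃[ m' ] (φ m' × ScaleR m' u m)

  [_]≔_ : (St → Set) → U → Assertion
  ([ P ]≔ u) m = Mass m u × (∀ σ → supp m σ → P σ)

  [_] : (St → Set) → Assertion
  [ P ] = [ P ]≔ 𝟙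

  □ : (St → Set) → Assertion
  □ P m = ∀ σ → supp m σ → P σ

  _⊨_≐_ : Assertion → Exp → U → Set
  φ ⊨ e ≐ u = ∀ m → φ m → ∀ σ → supp m σ → expSem e σ ≡ u

  Converges : (ℕ → Assertion) → Assertion → Set
  Converges ψ ψ∞ = ∀ (ms : ℕ → W) → (∀ n → ψ n (ms n)) →
    ∀ m → (∀ τ → HasSumOn (λ _ → ⊤) (λ n → fun (ms n) τ) (fun m τ)) → ψ∞ m

  Axioms : Set₁
  Axioms = Assertion → Act → Assertion → Set

  data _⊢⟨_⟩_⟨_⟩ (Γ : Axioms) : Assertion → Prog → Assertion → Set₁ where
    axiom  : ∀ {φ a ψ} → Γ φ a ψ → Γ ⊢⟨ φ ⟩ act a ⟨ ψ ⟩
    skipR  : ∀ {φ} → Γ ⊢⟨ φ ⟩ skip ⟨ φ ⟩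
    seqR   : ∀ {φ ϑ ψ C₁ C₂} → Γ ⊢⟨ φ ⟩ C₁ ⟨ ϑ ⟩ → Γ ⊢⟨ ϑ ⟩ C₂ ⟨ ψ ⟩ →
             Γ ⊢⟨ φ ⟩ C₁ ︔ C₂ ⟨ ψ ⟩
    plusR  : ∀ {φ ψ₁ ψ₂ C₁ C₂} → Γ ⊢⟨ φ ⟩ C₁ ⟨ ψ₁ ⟩ → Γ ⊢⟨ φ ⟩ C₂ ⟨ ψ₂ ⟩ →
             Γ ⊢⟨ φ ⟩ C₁ ⊕ₚ C₂ ⟨ ψ₁ ⊕ ψ₂ ⟩
    assumeR : ∀ {φ e u} → φ ⊨ e ≐ u → Γ ⊢⟨ φ ⟩ assume e ⟨ φ ⊙ʳ u ⟩
    iterR  : ∀ {C e e'} (φ ψ : ℕ → Assertion) (ψ∞ : Assertion) →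
             Converges ψ ψ∞ →
             (∀ n → Γ ⊢⟨ φ n ⟩ assume e ︔ C ⟨ φ (suc n) ⟩) →
             (∀ n → Γ ⊢⟨ φ n ⟩ assume e' ⟨ ψ n ⟩) →
             Γ ⊢⟨ φ zero ⟩ iter C e e' ⟨ ψ∞ ⟩
    falseR : ∀ {C φ} → Γ ⊢⟨ ⊥ₐ ⟩ C ⟨ φ ⟩
    trueR  : ∀ {C φ} → Γ ⊢⟨ φ ⟩ C ⟨ ⊤ₐ ⟩
    scaleR : ∀ {φ C ψ} (u : U) → Γ ⊢⟨ φ ⟩ C ⟨ ψ ⟩ → Γ ⊢⟨ u ⊙ˡ φ ⟩ C ⟨ u ⊙ˡ ψ ⟩
    disjR  : ∀ {φ₁ φ₂ ψ₁ ψ₂ C} → Γ ⊢⟨ φ₁ ⟩ C ⟨ ψ₁ ⟩ → Γ ⊢⟨ φ₂ ⟩ C ⟨ ψ₂ ⟩ →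
             Γ ⊢⟨ φ₁ ∨ₐ φ₂ ⟩ C ⟨ ψ₁ ∨ₐ ψ₂ ⟩
    conjR  : ∀ {φ₁ φ₂ ψ₁ ψ₂ C} → Γ ⊢⟨ φ₁ ⟩ C ⟨ ψ₁ ⟩ → Γ ⊢⟨ φ₂ ⟩ C ⟨ ψ₂ ⟩ →
             Γ ⊢⟨ φ₁ ∧ₐ φ₂ ⟩ C ⟨ ψ₁ ∧ₐ ψ₂ ⟩
    choiceR : ∀ {C} (T : Set) (φ φ' : T → Assertion) →
              (∀ t → Γ ⊢⟨ φ t ⟩ C ⟨ φ' t ⟩) → Γ ⊢⟨ ⨁ T φ ⟩ C ⟨ ⨁ T φ' ⟩
    existsR : ∀ {C} (T : Set) (φ φ' : T → Assertion) →
              (∀ t → Γ ⊢⟨ φ t ⟩ C ⟨ φ' t ⟩) → Γ ⊢⟨ ∃ₐ T φ ⟩ C ⟨ ∃ₐ T φ' ⟩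
    conseqR : ∀ {φ φ' ψ ψ' C} → φ' ⊆ φ → Γ ⊢⟨ φ ⟩ C ⟨ ψ ⟩ → ψ ⊆ ψ' →
              Γ ⊢⟨ φ' ⟩ C ⟨ ψ' ⟩

{-# OPTIONS --safe #-}
-- Only the precondition of the second triple has to be weakened from [ Q ] to □ Q.
-- Every m ∈ □ Q is the sum over σ of its point masses m(σ)·η(σ), and each of
-- these is either 𝟘·η(σ) or a multiple of η(σ) ∈ [ Q ]. (Scale) and (Exists)
-- give the triple for the multiples, (Scale) applied to (True) the one for the
-- 𝟘 pieces, (Choice) sums the pieces, and □ R is closed under such sums and
-- scalings. Excluded middle decides equality of states and vanishing of weights.
module Submission where

open import Defs
open import Level using (0ℓ)
open import Data.Bool using (Bool; if_then_else_)
open import Axiom.ExcludedMiddle using (ExcludedMiddle)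
open import Axiom.DoubleNegationElimination using (em⇒dne)
open import Data.List using (List; []; _∷_; map)
open import Data.List.Relation.Unary.All as All using (All; []; _∷_)
open import Data.List.Relation.Unary.AllPairs using ([]; _∷_)
open import Data.List.Relation.Unary.Unique.Propositional using (Unique)
open import Data.Maybe using (just)
open import Data.Nat using (zero)
open import Data.Product using (_×_; _,_; ∃-syntax)
open import Data.Sum using (inj₁; inj₂)
open import Data.Unit using (⊤; tt)
open import Function using (id; _∘_)
open import Relation.Nullary using (yes; no; does; contradiction)
open import Relation.Binary.PropositionalEquality using (_≡_; _≢_; refl; sym; trans; cong; subst)

module Sums (A : PartialSemiring) where
  open PartialSemiring A

  +-identityˡ : ∀ u → 𝟘 + u ≃ u
  +-identityˡ u = +-comm (+-identityʳ u)

  𝟘≤ : ∀ u → 𝟘 ≤ u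
  𝟘≤ u = u , +-identityˡ u

  ≤-refl : ∀ u → u ≤ u
  ≤-refl u = 𝟘 , +-identityʳ u

  FinSum-functional : ∀ {us s t} → FinSum us s → FinSum us t → s ≡ t
  FinSum-functional []ˢ []ˢ = refl
  FinSum-functional (consˢ Σs p) (consˢ Σt q) with FinSum-functional Σs Σt
  ... | refl = +-functional p q

  FinSum-zeros : ∀ {I : Set} {g : I → U} {is : List I} →
                 All (λ i → g i ≡ 𝟘) is → FinSum (map g is) 𝟘
  FinSum-zeros [] = []ˢ
  FinSum-zeros (gi≡𝟘 ∷ zeros) =
    consˢ (FinSum-zeros zeros) (subst (λ x → x + 𝟘 ≃ 𝟘) (sym gi≡𝟘) (+-identityʳ 𝟘))

  vanishing-sum≡𝟘 : ∀ {I : Set} {S : I → Set} {g : I → U} {s : U} →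
                    (∀ i → S i → g i ≡ 𝟘) → HasSumOn S g s → s ≡ 𝟘
  vanishing-sum≡𝟘 {S = S} {g} g≡𝟘 (_ , _ , least) = ≤-antisym (least 𝟘 partial≤𝟘) (𝟘≤ _)
    where
    partial≤𝟘 : ∀ t → ∃[ is ] (Unique is × All S is × FinSum (map g is) t) → t ≤ 𝟘
    partial≤𝟘 t (is , _ , is⊆S , Σt) =
      subst (_≤ 𝟘) (FinSum-functional (FinSum-zeros (All.map (g≡𝟘 _) is⊆S)) Σt) (≤-refl 𝟘)

  HasSumOn-single : ExcludedMiddle 0ℓ → ∀ {I : Set} {S : I → Set} {g : I → U} (i₀ : I) →
                    (∀ i → i ≢ i₀ → g i ≡ 𝟘) → (g i₀ ≢ 𝟘 → S i₀) → HasSumOn S g (g i₀)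
  HasSumOn-single em {S = S} {g} i₀ g≡𝟘 S-i₀ =
    (λ _ uniq _ → let t , Σt , _ = partial-sum uniq in t , Σt) , upper , least
    where
    partial-sum : ∀ {is} → Unique is → ∃[ t ] (FinSum (map g is) t × t ≤ g i₀)
    partial-sum [] = 𝟘 , []ˢ , 𝟘≤ (g i₀)
    partial-sum {i ∷ is} (i∉is ∷ uniq) with em {i ≡ i₀}
    ... | yes refl =
      g i₀ , consˢ (FinSum-zeros (All.map (λ i₀≢j → g≡𝟘 _ (i₀≢j ∘ sym)) i∉is)) (+-identityʳ (g i₀))
           , ≤-refl (g i₀)
    ... | no i≢i₀ =
      let t , Σt , t≤gi₀ = partial-sum uniq
      in  t , consˢ Σt (subst (λ x → x + t ≃ t) (sym (g≡𝟘 i i≢i₀)) (+-identityˡ t)) , t≤gi₀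

    upper : ∀ t → ∃[ is ] (Unique is × All S is × FinSum (map g is) t) → t ≤ g i₀
    upper t (_ , uniq , _ , Σt) =
      let t' , Σt' , t'≤gi₀ = partial-sum uniq
      in  subst (_≤ g i₀) (FinSum-functional Σt' Σt) t'≤gi₀

    least : ∀ b → (∀ t → ∃[ is ] (Unique is × All S is × FinSum (map g is) t) → t ≤ b) → g i₀ ≤ b
    least b bound with em {g i₀ ≡ 𝟘}
    ... | yes gi₀≡𝟘 = subst (_≤ b) (sym gi₀≡𝟘) (𝟘≤ b)
    ... | no gi₀≢𝟘 =
      bound (g i₀) (i₀ ∷ [] , [] ∷ [] , S-i₀ gi₀≢𝟘 ∷ [] , consˢ []ˢ (+-identityʳ (g i₀)))

module Decomposition (em : ExcludedMiddle 0ℓ) (A : PartialSemiring)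
                     (St Act PTest : Set) (testSem : PTest → St → Bool) where
  open PartialSemiring A
  open Sums A
  open Framework A St Act PTest testSem

  δ : U → St → St → U
  δ u σ τ = if does (em {τ ≡ σ}) then u else 𝟘

  δ-on : ∀ u σ → δ u σ σ ≡ u
  δ-on u σ with em {σ ≡ σ}
  ... | yes _ = refl
  ... | no σ≢σ = contradiction refl σ≢σ

  δ-off : ∀ u {σ τ} → τ ≢ σ → δ u σ τ ≡ 𝟘
  δ-off u {σ} {τ} τ≢σ with em {τ ≡ σ}
  ... | yes τ≡σ = contradiction τ≡σ τ≢σ
  ... | no _ = refl

  δ-supp : ∀ u {σ τ} → δ u σ τ ≢ 𝟘 → τ ≡ σ
  δ-supp u {σ} {τ} δ≢𝟘 with em {τ ≡ σ}
  ... | yes τ≡σ = τ≡σ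
  ... | no _ = contradiction refl δ≢𝟘

  δ-mass : ∀ u σ → HasSumOn (λ τ → δ u σ τ ≢ 𝟘) (δ u σ) u
  δ-mass u σ = subst (HasSumOn _ (δ u σ)) (δ-on u σ)
                     (HasSumOn-single em σ (λ _ → δ-off u) id)

  infix 8 _·η_
  _·η_ : U → St → W
  fun (u ·η σ) = δ u σ
  countable (u ·η σ) = (λ _ → just σ) , λ _ δ≢𝟘 → zero , cong just (sym (δ-supp u δ≢𝟘))
  mass-defined (u ·η σ) = u , δ-mass u σ

  η : St → W
  η σ = 𝟙 ·η σ

  η∈[_] : ∀ {Q σ} → Q σ → [ Q ] (η σ)
  η∈[ Q-σ ] = δ-mass 𝟙 _ , λ _ δ≢𝟘 → subst _ (sym (δ-supp 𝟙 δ≢𝟘)) Q-σ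

  ·η-scale : ∀ u σ → ScaleL u (η σ) (u ·η σ)
  ·η-scale u σ τ with em {τ ≡ σ}
  ... | yes _ = sym (·-identityʳ u)
  ... | no _ = sym (zeroʳ u)

  ·η-sum : ∀ m τ → HasSumOn (λ _ → ⊤) (λ σ → fun (fun m σ ·η σ) τ) (fun m τ)
  ·η-sum m τ = subst (HasSumOn _ _) (δ-on (fun m τ) τ)
                     (HasSumOn-single em τ (λ _ σ≢τ → δ-off _ (σ≢τ ∘ sym)) (λ _ → tt))

  -- The 𝟘 disjunct is needed because [ Q ] is empty when Q is.
  Scaled : (St → Set) → Assertion
  Scaled Q = (∃ₐ U λ u → u ⊙ˡ [ Q ]) ∨ₐ (𝟘 ⊙ˡ ⊤ₐ)

  □-decompose : ∀ Q → □ Q ⊆ ⨁ St (λ _ → Scaled Q)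
  □-decompose Q m m∈□Q = (λ σ → fun m σ ·η σ) , piece , ·η-sum m
    where
    piece : ∀ σ → Scaled Q (fun m σ ·η σ)
    piece σ with em {fun m σ ≡ 𝟘}
    ... | yes m-σ≡𝟘 =
      inj₂ (η σ , tt , subst (λ u → ScaleL u (η σ) (fun m σ ·η σ)) m-σ≡𝟘 (·η-scale _ σ))
    ... | no σ∈supp = inj₁ (fun m σ , η σ , η∈[ m∈□Q σ σ∈supp ] , ·η-scale _ σ)

  ⊙ˡ-□ : ∀ u R → (u ⊙ˡ □ R) ⊆ □ R
  ⊙ˡ-□ u R _ (m' , m'∈□R , scale) τ ≢𝟘 =
    m'∈□R τ (λ m'-τ≡𝟘 → ≢𝟘 (trans (scale τ) (trans (cong (u ·_) m'-τ≡𝟘) (zeroʳ u))))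

  𝟘⊙ˡ-□ : ∀ φ R → (𝟘 ⊙ˡ φ) ⊆ □ R
  𝟘⊙ˡ-□ φ R _ (_ , _ , scale) τ ≢𝟘 = contradiction (trans (scale τ) (zeroˡ _)) ≢𝟘

  ⨁-□ : ∀ T R → ⨁ T (λ _ → □ R) ⊆ □ R
  ⨁-□ T R m (ms , ms∈□R , sum) τ m-τ≢𝟘 = em⇒dne em λ ¬R-τ →
    m-τ≢𝟘 (vanishing-sum≡𝟘 (λ t _ → em⇒dne em (¬R-τ ∘ ms∈□R t τ)) (sum τ))

  ⊢-Scaled : ∀ {Γ C Q R} → Γ ⊢⟨ [ Q ] ⟩ C ⟨ □ R ⟩ → Γ ⊢⟨ Scaled Q ⟩ C ⟨ □ R ⟩
  ⊢-Scaled {R = R} ⊢C =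
    conseqR (λ _ → id) (disjR (existsR U _ _ (λ u → scaleR u ⊢C)) (scaleR 𝟘 trueR)) post
    where
    post : (∃ₐ U (λ u → u ⊙ˡ □ R) ∨ₐ (𝟘 ⊙ˡ ⊤ₐ)) ⊆ □ R
    post m (inj₁ (u , m∈u□R)) = ⊙ˡ-□ u R m m∈u□R
    post m (inj₂ m∈𝟘⊤)       = 𝟘⊙ˡ-□ ⊤ₐ R m m∈𝟘⊤

  ⊢-[]⇒□ : ∀ {Γ C Q R} → Γ ⊢⟨ [ Q ] ⟩ C ⟨ □ R ⟩ → Γ ⊢⟨ □ Q ⟩ C ⟨ □ R ⟩
  ⊢-[]⇒□ {Q = Q} {R} ⊢C =
    conseqR (□-decompose Q) (choiceR St _ _ (λ _ → ⊢-Scaled ⊢C)) (⨁-□ St R)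

lemmaE2 : ExcludedMiddle 0ℓ →
    (A : PartialSemiring) (St Act PTest : Set) (testSem : PTest → St → Bool) →
    let open Framework A St Act PTest testSem in
    (actSem : Act → St → W) (Γ : Axioms) (C₁ C₂ : Prog) (P Q R : St → Set) →
    WellFormed actSem C₁ → WellFormed actSem C₂ →
    Γ ⊢⟨ [ P ] ⟩ C₁ ⟨ □ Q ⟩ → Γ ⊢⟨ [ Q ] ⟩ C₂ ⟨ □ R ⟩ →
    Γ ⊢⟨ [ P ] ⟩ C₁ ︔ C₂ ⟨ □ R ⟩
lemmaE2 em A St Act PTest testSem _ _ _ _ _ _ _ _ _ ⊢C₁ ⊢C₂ = seqR ⊢C₁ (⊢-[]⇒□ ⊢C₂)
  where
  open Framework A St Act PTest testSem using (seqR)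
  open Decomposition em A St Act PTest testSem using (⊢-[]⇒□)
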